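{- Let $k \geq 2$ be an integer and let $G$ be the graph obtained from two disjoint copies of the helm $H_4$ and a path $P_k = u_1u_2\cdots u_k$ (of length $k-1$, disjoint from the helms except as follows) by identifying $u_1$ with the apex vertex of the first copy of $H_4$ and $u_k$ with the apex vertex of the second copy of $H_4$. Then $G$ admits a signed product cordial labeling.
   Context: All graphs are finite, simple and undirected. A vertex labeling $\alpha: V(G) \to \{1,-1\}$ induces the edge labeling $\alpha^*: E(G) \to \{1,-1\}$ given by $\alpha^*(uv) = \alpha(u)\alpha(v)$. For $a \in \{1,-1\}$, let $v_\alpha(a)$ be the number of vertices labeled $a$ and $e_{\alpha^*}(a)$ the number of edges labeled $a$. The labeling $\alpha$ is a signed product cordial labeling if $|v_\alpha(-1) - v_\alpha(1)| \leq 1$ and $|e_{\alpha^*}(-1) - e_{\alpha^*}(1)| \leq 1$. The wheel $W_4$ consists of a cycle (the rim) $v_1v_2v_3v_4v_1$ together with an apex vertex $v_0$ adjacent to all of $v_1,\dots,v_4$. The helm $H_4$ is obtained from $W_4$ by attaching a new pendant vertex $v_i'$ to each rim vertex $v_i$, $1 \le i \le 4$; it has $9$ vertices and $12$ edges. -}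

module Defs where

open import Data.Nat using (ℕ; zero; suc; _+_; _≤_; NonZero)
open import Data.Fin using (Fin; zero; suc; _↑ˡ_; _↑ʳ_; inject₁; fromℕ)
open import Data.List using (List; []; _∷_; _++_; map; concatMap; filter; length; allFin)
open import Data.Product using (_×_; _,_; proj₁; proj₂; Σ)
open import Data.Sign using (Sign; _*_) renaming (+ to pos; - to neg)
open import Data.Sign.Properties using () renaming (_≟_ to _≟ₛ_)
open import Relation.Binary.PropositionalEquality using (_≡_)

-- A finite graph on vertex set Fin n, given by its list of edges
-- (each unordered edge listed exactly once).
record Graph : Set where
  field
    order : ℕ
    edges : List (Fin order × Fin order)
open Graph public

-- Vertex labels in {1,-1}, represented by Data.Sign (pos = 1, neg = -1).
Labeling : Graph → Set
Labeling G = Fin (order G) → Sign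

vcount : (G : Graph) → Labeling G → Sign → ℕ
vcount G α a = length (filter (λ v → α v ≟ₛ a) (allFin (order G)))

ecount : (G : Graph) → Labeling G → Sign → ℕ
ecount G α a = length (filter (λ e → (α (proj₁ e) * α (proj₂ e)) ≟ₛ a) (edges G))

AbsDiffLe1 : ℕ → ℕ → Set
AbsDiffLe1 x y = (x ≤ suc y) × (y ≤ suc x)

IsSignedProductCordial : (G : Graph) → Labeling G → Set
IsSignedProductCordial G α =
  AbsDiffLe1 (vcount G α neg) (vcount G α pos) ×
  AbsDiffLe1 (ecount G α neg) (ecount G α pos)

HasSignedProductCordialLabeling : Graph → Set
HasSignedProductCordialLabeling G = Σ (Labeling G) (IsSignedProductCordial G)

next4 : Fin 4 → Fin 4
next4 zero = suc zero
next4 (suc zero) = suc (suc zero)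
next4 (suc (suc zero)) = suc (suc (suc zero))
next4 (suc (suc (suc zero))) = zero

-- Vertex set Fin (16 + k):
--   rim vertex rim c i  (c : Fin 2 copy, i : Fin 4):  rim vertex v_{i+1} of copy c
--   pendant pend c i :  pendant v'_{i+1} of copy c
--   path           u j   (j : Fin k) : u_{j+1}
-- The apex of copy 0 is identified with u_1 (index 0), the apex of
-- copy 1 with u_k (index k-1).
HelmPathHelm : (k : ℕ) → .{{NonZero k}} → Graph
HelmPathHelm (suc m) = record { order = 16 + suc m ; edges = helmEdges ++ pathEdges }
  where
    V = Fin (16 + suc m)
    -- layout of Fin 16: rims of copy 0 = 0..3, pendants of copy 0 = 4..7,
    -- rims of copy 1 = 8..11, pendants of copy 1 = 12..15
    hr : Fin 2 → Fin 4 → Fin 16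
    hr zero i = i ↑ˡ 12
    hr (suc zero) i = 8 ↑ʳ (i ↑ˡ 4)
    hp : Fin 2 → Fin 4 → Fin 16
    hp zero i = 4 ↑ʳ (i ↑ˡ 8)
    hp (suc zero) i = 12 ↑ʳ i
    rim : Fin 2 → Fin 4 → V
    rim c i = hr c i ↑ˡ suc m
    pend : Fin 2 → Fin 4 → V
    pend c i = hp c i ↑ˡ suc m
    u : Fin (suc m) → V
    u j = 16 ↑ʳ j
    apex : Fin 2 → V
    apex zero = u zero
    apex (suc zero) = u (fromℕ m)
    helmEdgesOf : Fin 2 → Fin 4 → List (V × V)
    helmEdgesOf c i = (rim c i , rim c (next4 i)) ∷ (apex c , rim c i) ∷ (rim c i , pend c i) ∷ []
    helmEdges : List (V × V)
    helmEdges = concatMap (λ c → concatMap (helmEdgesOf c) (allFin 4)) (allFin 2)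
    pathEdges : List (V × V)
    pathEdges = map (λ j → (u (inject₁ j) , u (suc j))) (allFin m)

-- Label the path u₁u₂u₃u₄… by + − − + + − − + …, so that consecutive pairs of
-- labels are opposite; then the vertex labels and the edge labels (which
-- alternate − + − + …) along the path are balanced on every prefix.  In each
-- helm, label the rim v₁…v₄ by + − − + and the pendants by + + − −: its eight
-- non-apex vertices split 4/4, and its twelve edges split 6/6 whatever the
-- apex label, because the spokes split like the rim labels.  The helms thus add
-- equal numbers of both signs and the path alone decides the imbalance.
module Submission where

open import Defs
open import Data.Nat using (ℕ; _≤_; >-nonZero; s≤s; z≤n; zero; suc; _+_)
open import Data.Nat.Properties using (≤-trans; ≤-reflexive; +-monoʳ-≤; +-suc)
open import Data.Fin using (Fin; zero; suc; toℕ; splitAt; _↑ʳ_; inject₁; fromℕ)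
open import Data.Fin.Properties using (toℕ-inject₁)
open import Data.List using (List; []; _∷_; _++_; map; filter; length; allFin; applyUpTo; tabulate; concatMap)
open import Data.List.Properties using (length-++; filter-++; map-∘; map-tabulate; tabulate-cong)
open import Data.Product using (_×_; _,_; proj₁; proj₂)
open import Data.Sign using (Sign; _*_; opposite) renaming (+ to pos; - to neg)
open import Data.Sign.Properties using () renaming (_≟_ to _≟ₛ_)
open import Data.Sum using ([_,_]′)
open import Function using (_∘_; _∘′_; id)
open import Relation.Binary.PropositionalEquality
  using (_≡_; refl; sym; trans; cong; subst; subst₂)
open import Relation.Nullary using (yes; no)

countSign : Sign → List Sign → ℕ
countSign a xs = length (filter (_≟ₛ a) xs)

countSign-++ : ∀ a xs ys → countSign a (xs ++ ys) ≡ countSign a xs + countSign a ys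
countSign-++ a xs ys =
  trans (cong length (filter-++ (_≟ₛ a) xs ys)) (length-++ (filter (_≟ₛ a) xs))

length-filter-≟-map : ∀ {X : Set} (f : X → Sign) a xs →
  length (filter (λ x → f x ≟ₛ a) xs) ≡ countSign a (map f xs)
length-filter-≟-map f a [] = refl
length-filter-≟-map f a (x ∷ xs) with f x ≟ₛ a
... | yes _ = cong suc (length-filter-≟-map f a xs)
... | no _  = length-filter-≟-map f a xs

Balanced : List Sign → Set
Balanced xs = AbsDiffLe1 (countSign neg xs) (countSign pos xs)

EvenlySplit : List Sign → Set
EvenlySplit xs = countSign neg xs ≡ countSign pos xs

balanced⇒isSignedProductCordial : (G : Graph) (α : Labeling G) →
  Balanced (map α (allFin (order G))) →
  Balanced (map (λ e → α (proj₁ e) * α (proj₂ e)) (edges G)) →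
  IsSignedProductCordial G α
balanced⇒isSignedProductCordial G α verticesBalanced edgesBalanced =
  subst₂ AbsDiffLe1 (sym (vertexCount neg)) (sym (vertexCount pos)) verticesBalanced ,
  subst₂ AbsDiffLe1 (sym (edgeCount neg)) (sym (edgeCount pos)) edgesBalanced
  where
  edgeSign : Fin (order G) × Fin (order G) → Sign
  edgeSign e = α (proj₁ e) * α (proj₂ e)
  vertexCount : ∀ a → vcount G α a ≡ countSign a (map α (allFin (order G)))
  vertexCount a = length-filter-≟-map α a (allFin (order G))
  edgeCount : ∀ a → ecount G α a ≡ countSign a (map edgeSign (edges G))
  edgeCount a = length-filter-≟-map edgeSign a (edges G)

+-monoʳ-AbsDiffLe1 : ∀ n {x y} → AbsDiffLe1 x y → AbsDiffLe1 (n + x) (n + y)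
+-monoʳ-AbsDiffLe1 n {x} {y} (x≤1+y , y≤1+x) =
  ≤-trans (+-monoʳ-≤ n x≤1+y) (≤-reflexive (+-suc n y)) ,
  ≤-trans (+-monoʳ-≤ n y≤1+x) (≤-reflexive (+-suc n x))

balanced-++ : ∀ ys xs → EvenlySplit ys → Balanced xs → Balanced (ys ++ xs)
balanced-++ ys xs even balanced
  rewrite countSign-++ neg ys xs | countSign-++ pos ys xs | even =
  +-monoʳ-AbsDiffLe1 (countSign pos ys) balanced

balanced-[_] : ∀ a → Balanced (a ∷ [])
balanced-[ pos ] = z≤n , s≤s z≤n
balanced-[ neg ] = s≤s z≤n , z≤n

evenlySplit-opposite : ∀ a → EvenlySplit (a ∷ opposite a ∷ [])
evenlySplit-opposite pos = refl
evenlySplit-opposite neg = refl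

OppositePairs : (ℕ → Sign) → Set
OppositePairs s = ∀ i → s (suc (i + i)) ≡ opposite (s (i + i))

oppositePairs-balanced : ∀ s → OppositePairs s → ∀ n → Balanced (applyUpTo s n)
oppositePairs-balanced s opp zero = z≤n , z≤n
oppositePairs-balanced s opp (suc zero) = balanced-[ s 0 ]
oppositePairs-balanced s opp (suc (suc n)) =
  balanced-++ (s 0 ∷ s 1 ∷ []) (applyUpTo s″ n) firstPair (oppositePairs-balanced s″ opp′ n)
  where
  firstPair : EvenlySplit (s 0 ∷ s 1 ∷ [])
  firstPair = subst (λ b → EvenlySplit (s 0 ∷ b ∷ [])) (sym (opp 0)) (evenlySplit-opposite (s 0))
  s″ : ℕ → Sign
  s″ j = s (suc (suc j))
  opp′ : OppositePairs s″
  opp′ i = subst (λ j → s (suc (suc j)) ≡ opposite (s (suc j))) (+-suc i i) (opp (suc i))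

tabulate-toℕ : ∀ {A : Set} n (s : ℕ → A) → tabulate {n = n} (s ∘ toℕ) ≡ applyUpTo s n
tabulate-toℕ zero    s = refl
tabulate-toℕ (suc n) s = cong (s 0 ∷_) (tabulate-toℕ n (s ∘′ suc))

*-opposite : ∀ a b → a * opposite b ≡ opposite (b * a)
*-opposite pos pos = refl
*-opposite pos neg = refl
*-opposite neg pos = refl
*-opposite neg neg = refl

pathSign : ℕ → Sign
pathSign 0 = pos
pathSign 1 = neg
pathSign (suc (suc n)) = opposite (pathSign n)

pathSign-oppositePairs : OppositePairs pathSign
pathSign-oppositePairs zero = refl
pathSign-oppositePairs (suc i) rewrite +-suc i i = cong opposite (pathSign-oppositePairs i)

pathEdgeSign : ℕ → Sign
pathEdgeSign n = pathSign n * pathSign (suc n)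

pathEdgeSign-suc : ∀ n → pathEdgeSign (suc n) ≡ opposite (pathEdgeSign n)
pathEdgeSign-suc n = *-opposite (pathSign (suc n)) (pathSign n)

rimSign : Fin 4 → Sign
rimSign zero = pos
rimSign (suc zero) = neg
rimSign (suc (suc zero)) = neg
rimSign (suc (suc (suc zero))) = pos

pendantSign : Fin 4 → Sign
pendantSign zero = pos
pendantSign (suc zero) = pos
pendantSign (suc (suc zero)) = neg
pendantSign (suc (suc (suc zero))) = neg

-- Matches the vertex layout of HelmPathHelm: rims, then pendants.
helmSign : Fin 8 → Sign
helmSign = [ rimSign , pendantSign ]′ ∘ splitAt 4

helmEdgeSigns : Sign → List Sign
helmEdgeSigns apex = concatMap
  (λ i → rimSign i * rimSign (next4 i) ∷ apex * rimSign i ∷ rimSign i * pendantSign i ∷ [])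
  (allFin 4)

helmEdgeSigns-evenlySplit : ∀ apex → EvenlySplit (helmEdgeSigns apex)
helmEdgeSigns-evenlySplit pos = refl
helmEdgeSigns-evenlySplit neg = refl

helmsSign : Fin 16 → Sign
helmsSign = [ helmSign , helmSign ]′ ∘ splitAt 8

module _ (m : ℕ) where

  G : Graph
  G = HelmPathHelm (suc m)

  labeling : Labeling G
  labeling = [ helmsSign , pathSign ∘ toℕ ]′ ∘ splitAt 16

  edgeSign : Fin (order G) × Fin (order G) → Sign
  edgeSign e = labeling (proj₁ e) * labeling (proj₂ e)

  lastPathSign : Sign
  lastPathSign = pathSign (toℕ (fromℕ m))

  vertexSigns : map labeling (allFin (order G)) ≡ tabulate helmsSign ++ applyUpTo pathSign (suc m)
  vertexSigns = trans (map-tabulate id labeling)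
    (cong (tabulate helmsSign ++_) (tabulate-toℕ (suc m) pathSign))

  pathEdgeSigns : map edgeSign (map (λ j → (16 ↑ʳ inject₁ j , 16 ↑ʳ suc j)) (allFin m)) ≡
                  applyUpTo pathEdgeSign m
  pathEdgeSigns = trans (sym (map-∘ (allFin m)))
    (trans (map-tabulate id _)
    (trans (tabulate-cong (λ j → cong (λ t → pathSign t * pathSign (suc (toℕ j))) (toℕ-inject₁ j)))
      (tabulate-toℕ m pathEdgeSign)))

  edgeSigns : map edgeSign (edges G) ≡
              helmEdgeSigns pos ++ helmEdgeSigns lastPathSign ++ applyUpTo pathEdgeSign m
  edgeSigns = cong (λ path → helmEdgeSigns pos ++ helmEdgeSigns lastPathSign ++ path) pathEdgeSigns

  vertexSigns-balanced : Balanced (map labeling (allFin (order G)))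
  vertexSigns-balanced = subst Balanced (sym vertexSigns)
    (balanced-++ (tabulate helmsSign) (applyUpTo pathSign (suc m)) refl
      (oppositePairs-balanced pathSign pathSign-oppositePairs (suc m)))

  edgeSigns-balanced : Balanced (map edgeSign (edges G))
  edgeSigns-balanced = subst Balanced (sym edgeSigns)
    (balanced-++ (helmEdgeSigns pos) (helmEdgeSigns lastPathSign ++ applyUpTo pathEdgeSign m)
      (helmEdgeSigns-evenlySplit pos)
      (balanced-++ (helmEdgeSigns lastPathSign) (applyUpTo pathEdgeSign m)
        (helmEdgeSigns-evenlySplit lastPathSign)
        (oppositePairs-balanced pathEdgeSign (λ i → pathEdgeSign-suc (i + i)) m)))

-- The construction also works for k = 1.
theorem2p4 : (k : ℕ) (k≥2 : 2 ≤ k) →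
    HasSignedProductCordialLabeling
    (HelmPathHelm k {{>-nonZero (≤-trans (s≤s z≤n) k≥2)}})
theorem2p4 (suc m) _ = labeling m ,
  balanced⇒isSignedProductCordial (G m) (labeling m) (vertexSigns-balanced m) (edgeSigns-balanced m)
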